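{- Let $\Pi$ be a nonempty finite set of permutations, the largest of which has size $k$. Then for every $n>k$, \[ S_n(\Pi)=\bigcap_{j=1}^{k+1}\ \bigcup_{i=1}^{n} S_{n-1}(\Pi)\uparrow^i_j. \]
   Context: A permutation in $S_m$ is a word containing each of $1,\dots,m$ exactly once. For $\pi\in S_m$ and $\tau\in S_n$, a $\pi$-hit in $\tau$ is an $m$-letter subsequence of $\tau$ order-isomorphic to $\pi$; $S_n(\Pi)$ is the set of $\tau\in S_n$ having no $\pi$-hit for any $\pi\in\Pi$. For $s\in S_{n-1}$, $i\in\{1,\dots,n\}$ and $j\in\{1,\dots,n\}$, $s\uparrow^i_j$ is the permutation in $S_n$ obtained by inserting the value $j-0.5$ into $s$ so that it becomes the $i$-th letter, and then standardizing (replacing the letters by $1,\dots,n$ preserving relative order); e.g. $12345678\uparrow^2_5=152346789$. For a set $A$ of permutations, $A\uparrow^i_j=\{s\uparrow^i_j : s\in A\}$. -}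

module Defs where

open import Data.Nat using (ℕ; zero; suc; _<_; _<ᵇ_; _⊔_; _∸_)
open import Data.Bool using (if_then_else_)
open import Data.List using (List; []; _∷_; map; length; applyUpTo; foldr)
open import Data.List.Relation.Binary.Permutation.Propositional using (_↭_)
open import Data.List.Relation.Binary.Pointwise using (Pointwise)
open import Data.List.Relation.Binary.Sublist.Propositional using (_⊆_)
open import Data.List.Relation.Unary.All using (All)
open import Data.Product using (_×_; ∃)
open import Function.Bundles using (_⇔_)
open import Relation.Nullary using (¬_)

IsPerm : ℕ → List ℕ → Set
IsPerm m w = w ↭ applyUpTo suc m

-- Order-isomorphism of two words (same length, same relative order of letters).
data OrdIso : List ℕ → List ℕ → Set where
  []  : OrdIso [] []
  _∷_ : ∀ {x y xs ys} →
        Pointwise (λ a b → ((x < a) ⇔ (y < b)) × ((a < x) ⇔ (b < y))) xs ys →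
        OrdIso xs ys → OrdIso (x ∷ xs) (y ∷ ys)

Contains : List ℕ → List ℕ → Set
Contains τ π = ∃ λ σ → (σ ⊆ τ) × OrdIso σ π

Avoids : List (List ℕ) → List ℕ → Set
Avoids Π τ = All (λ π → ¬ Contains τ π) Π

InS : ℕ → List (List ℕ) → List ℕ → Set
InS n Π τ = IsPerm n τ × Avoids Π τ

maxLen : List (List ℕ) → ℕ
maxLen Π = foldr _⊔_ 0 (map length Π)

-- insert v so that it becomes the letter with 0-based index p
insAt : ℕ → ℕ → List ℕ → List ℕ
insAt zero    v xs       = v ∷ xs
insAt (suc p) v []       = v ∷ []
insAt (suc p) v (x ∷ xs) = x ∷ insAt p v xs

-- standardization after inserting j - 0.5: letters ≥ j are increased by one
bump : ℕ → ℕ → ℕ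
bump j x = if x <ᵇ j then x else suc x

-- s ↑^i_j  (i, j ∈ {1..n}, 1-based): new letter j at position i
up : List ℕ → ℕ → ℕ → List ℕ
up s i j = insAt (i ∸ 1) j (map (bump j) s)

-- Since bump j is an order embedding, and order embeddings neither
-- create nor destroy pattern hits, the proof reduces to two facts:
--   * Deletion (⊆): every letter j of a permutation τ of [1..n] can be
--     removed, i.e. τ = s↑^i_j for a permutation s of [1..n-1]; a π-hit in
--     s is carried by bump j to a π-hit in τ, so s inherits avoidance.
--   * Free letter (⊇): a π-hit σ in τ has at most k letters, so some
--     j ∈ {1..k+1} does not occur in σ; writing τ = s↑^i_j, the hit σ lives
--     inside map (bump j) s and pulls back to a π-hit in s.
module Submission where

open import Defs
open import Data.Nat using (ℕ; zero; suc; pred; _<_; _≤_; _∸_; _+_; _<ᵇ_; z≤n; s≤s; s<s; s<s⁻¹)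
open import Data.Nat.Properties
open import Data.Bool using (true; false; if_then_else_)
open import Data.List using (List; []; _∷_; _++_; length; map; applyUpTo)
open import Data.List.Properties using (map-applyUpTo; map-∘; map-cong; map-id-local; length-applyUpTo; length-++)
open import Data.List.Relation.Unary.All using (All)
import Data.List.Relation.Unary.All as All
open import Data.List.Relation.Unary.Any using (here; there)
open import Data.List.Relation.Binary.Pointwise using (Pointwise; []; _∷_)
open import Data.List.Relation.Binary.Sublist.Propositional using (_⊆_; []; _∷_; _∷ʳ_; ⊆-trans; ⊆-refl)
import Data.List.Relation.Binary.Sublist.Propositional.Properties as Sublist
open import Data.List.Relation.Binary.Permutation.Propositional using (_↭_; ↭-refl; ↭-sym; ↭-trans; ↭-reflexive; prep; swap)
open import Data.List.Relation.Binary.Permutation.Propositional.Properties using (drop-∷; ∈-resp-↭; ↭-length)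
import Data.List.Relation.Binary.Permutation.Propositional.Properties as Perm
open import Data.List.Membership.Propositional using (_∈_; _∉_)
open import Data.List.Membership.Propositional.Properties using (∈-map⁻; ∈-∃++; ∈-++⁻; ∈-++⁺ˡ; ∈-++⁺ʳ)
open import Data.List.Membership.DecPropositional _≟_ using (_∈?_)
open import Data.Sum using (inj₁; inj₂)
open import Data.Product using (_×_; ∃; _,_)
open import Function using (_∘_)
open import Function.Bundles using (_⇔_; mk⇔)
open import Function.Properties.Equivalence using () renaming (sym to ⇔-sym; trans to ⇔-trans)
open import Relation.Nullary using (¬_; yes; no; contradiction)
open import Relation.Nullary.Reflects using (ofʸ; ofⁿ)
open import Relation.Binary.PropositionalEquality

if-below : ∀ {A : Set} {x j} (a b : A) → x < j → (if x <ᵇ j then a else b) ≡ a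
if-below {x = x} {j} a b x<j with x <ᵇ j | <ᵇ-reflects-< x j
... | true  | _        = refl
... | false | ofⁿ x≮j = contradiction x<j x≮j

if-above : ∀ {A : Set} {x j} (a b : A) → j ≤ x → (if x <ᵇ j then a else b) ≡ b
if-above {x = x} {j} a b j≤x with x <ᵇ j | <ᵇ-reflects-< x j
... | true  | ofʸ x<j = contradiction j≤x (<⇒≱ x<j)
... | false | _       = refl

bump-≢ : ∀ j x → bump j x ≢ j
bump-≢ j x with x <? j
... | yes x<j = λ eq → <-irrefl (trans (sym (if-below x (suc x) x<j)) eq) x<j
... | no  x≮j = λ eq → <-irrefl (sym (trans (sym (if-above x (suc x) (≮⇒≥ x≮j))) eq)) (s≤s (≮⇒≥ x≮j))

OrderEmbedding : (ℕ → ℕ) → Set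
OrderEmbedding f = ∀ a b → (a < b) ⇔ (f a < f b)

bump-embedding : ∀ j → OrderEmbedding (bump j)
bump-embedding j a b with a <? j | b <? j
... | yes a<j | yes b<j rewrite if-below a (suc a) a<j | if-below b (suc b) b<j =
  mk⇔ (λ a<b → a<b) (λ a<b → a<b)
... | yes a<j | no b≮j rewrite if-below a (suc a) a<j | if-above b (suc b) (≮⇒≥ b≮j) =
  mk⇔ (λ _ → m<n⇒m<1+n a<b) (λ _ → a<b)
  where a<b = <-≤-trans a<j (≮⇒≥ b≮j)
... | no a≮j | yes b<j rewrite if-above a (suc a) (≮⇒≥ a≮j) | if-below b (suc b) b<j =
  mk⇔ (λ a<b → contradiction (<-trans a<b b<j) a≮j)
      (λ 1+a<b → contradiction (<-trans (<-trans (n<1+n a) 1+a<b) b<j) a≮j)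
... | no a≮j | no b≮j rewrite if-above a (suc a) (≮⇒≥ a≮j) | if-above b (suc b) (≮⇒≥ b≮j) =
  mk⇔ s<s s<s⁻¹

bump-suc : ∀ j x → bump (suc j) (suc x) ≡ suc (bump j x)
bump-suc j x with x <ᵇ j
... | true  = refl
... | false = refl

unbump : ℕ → ℕ → ℕ
unbump j x = if x <ᵇ j then x else pred x

unbump-bump : ∀ j x → unbump j (bump j x) ≡ x
unbump-bump j x with x <? j
... | yes x<j rewrite if-below x (suc x) x<j = if-below x (pred x) x<j
... | no  x≮j rewrite if-above x (suc x) (≮⇒≥ x≮j) = if-above (suc x) x (m≤n⇒m≤1+n (≮⇒≥ x≮j))

bump-unbump : ∀ j x → x ≢ j → bump j (unbump j x) ≡ x
bump-unbump j x x≢j with x <? j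
... | yes x<j rewrite if-below x (pred x) x<j = if-below x (suc x) x<j
... | no  x≮j with ≤∧≢⇒< (≮⇒≥ x≮j) (x≢j ∘ sym)
...   | j<x@(s≤s j≤x') rewrite if-above x (pred x) (<⇒≤ j<x) = if-above (pred x) x j≤x'

module _ {f : ℕ → ℕ} (embed : OrderEmbedding f) where

  ordIso-map⁺ : ∀ {xs ys} → OrdIso xs ys → OrdIso (map f xs) ys
  ordIso-map⁺ [] = []
  ordIso-map⁺ {x ∷ _} (agree ∷ iso) = transport agree ∷ ordIso-map⁺ iso
    where
    transport : ∀ {y as bs} → Pointwise (λ a b → ((x < a) ⇔ (y < b)) × ((a < x) ⇔ (b < y))) as bs →
                Pointwise (λ a b → ((f x < a) ⇔ (y < b)) × ((a < f x) ⇔ (b < y))) (map f as) bs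
    transport [] = []
    transport {as = a ∷ _} ((above , below) ∷ rest) =
      (⇔-trans (⇔-sym (embed x a)) above , ⇔-trans (⇔-sym (embed a x)) below) ∷ transport rest

  ordIso-map⁻ : ∀ {xs ys} → OrdIso (map f xs) ys → OrdIso xs ys
  ordIso-map⁻ {[]} [] = []
  ordIso-map⁻ {x ∷ _} (agree ∷ iso) = transport agree ∷ ordIso-map⁻ iso
    where
    transport : ∀ {y as bs} → Pointwise (λ a b → ((f x < a) ⇔ (y < b)) × ((a < f x) ⇔ (b < y))) (map f as) bs →
                Pointwise (λ a b → ((x < a) ⇔ (y < b)) × ((a < x) ⇔ (b < y))) as bs
    transport {as = []} [] = []
    transport {as = a ∷ _} ((above , below) ∷ rest) =
      (⇔-trans (embed x a) above , ⇔-trans (embed a x) below) ∷ transport rest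

ordIso-length : ∀ {xs ys} → OrdIso xs ys → length xs ≡ length ys
ordIso-length [] = refl
ordIso-length (_ ∷ iso) = cong suc (ordIso-length iso)

⊆-map⁻ : ∀ (f : ℕ → ℕ) {σ} xs → σ ⊆ map f xs → ∃ λ σ′ → (σ′ ⊆ xs) × (σ ≡ map f σ′)
⊆-map⁻ f [] [] = [] , [] , refl
⊆-map⁻ f (x ∷ xs) (_ ∷ʳ sub) with ⊆-map⁻ f xs sub
... | σ′ , σ′⊆xs , refl = σ′ , x ∷ʳ σ′⊆xs , refl
⊆-map⁻ f (x ∷ xs) (refl ∷ sub) with ⊆-map⁻ f xs sub
... | σ′ , σ′⊆xs , refl = x ∷ σ′ , refl ∷ σ′⊆xs , refl

insAt-↭ : ∀ p (v : ℕ) xs → insAt p v xs ↭ v ∷ xs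
insAt-↭ zero    v xs       = ↭-refl
insAt-↭ (suc p) v []       = ↭-refl
insAt-↭ (suc p) v (x ∷ xs) = ↭-trans (prep x (insAt-↭ p v xs)) (swap x v ↭-refl)

⊆-insAt : ∀ p (v : ℕ) xs → xs ⊆ insAt p v xs
⊆-insAt zero    v xs       = v ∷ʳ ⊆-refl
⊆-insAt (suc p) v []       = v ∷ʳ []
⊆-insAt (suc p) v (x ∷ xs) = refl ∷ ⊆-insAt p v xs

⊆-insAt⁻ : ∀ p (v : ℕ) xs {σ} → σ ⊆ insAt p v xs → v ∉ σ → σ ⊆ xs
⊆-insAt⁻ zero    v xs       (_ ∷ʳ sub)  v∉σ = sub
⊆-insAt⁻ zero    v xs       (refl ∷ _)  v∉σ = contradiction (here refl) v∉σ
⊆-insAt⁻ (suc p) v []       (_ ∷ʳ [])   v∉σ = []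
⊆-insAt⁻ (suc p) v []       (refl ∷ _)  v∉σ = contradiction (here refl) v∉σ
⊆-insAt⁻ (suc p) v (x ∷ xs) (_ ∷ʳ sub)  v∉σ = x ∷ʳ ⊆-insAt⁻ p v xs sub v∉σ
⊆-insAt⁻ (suc p) v (x ∷ xs) (refl ∷ sub) v∉σ = refl ∷ ⊆-insAt⁻ p v xs sub (v∉σ ∘ there)

∈⇒insAt : ∀ {v : ℕ} {xs} → v ∈ xs → ∃ λ p → ∃ λ rest → (xs ≡ insAt p v rest) × (p < length xs)
∈⇒insAt {xs = x ∷ xs} (here refl) = 0 , xs , refl , s≤s z≤n
∈⇒insAt {xs = x ∷ xs} (there v∈xs) with ∈⇒insAt v∈xs
... | p , rest , refl , p<len = suc p , x ∷ rest , refl , s≤s p<len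

contains-up : ∀ {s π} i j → Contains s π → Contains (up s i j) π
contains-up {s} i j (σ , σ⊆s , iso) =
  map (bump j) σ ,
  ⊆-trans (Sublist.map⁺ (bump j) σ⊆s) (⊆-insAt (i ∸ 1) j _) ,
  ordIso-map⁺ (bump-embedding j) iso

contains-up⁻ : ∀ {s π σ} i j → σ ⊆ up s i j → j ∉ σ → OrdIso σ π → Contains s π
contains-up⁻ {s} i j σ⊆up j∉σ iso with ⊆-map⁻ (bump j) s (⊆-insAt⁻ (i ∸ 1) j _ σ⊆up j∉σ)
... | σ′ , σ′⊆s , refl = σ′ , σ′⊆s , ordIso-map⁻ (bump-embedding j) iso

avoids-up⁻ : ∀ {Π s} i j → Avoids Π (up s i j) → Avoids Π s
avoids-up⁻ i j = All.map (λ noHit hit → noHit (contains-up i j hit))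

upTo-suc : ∀ m → applyUpTo suc (suc m) ≡ 1 ∷ map suc (applyUpTo suc m)
upTo-suc m = cong (1 ∷_) (sym (map-applyUpTo suc suc m))

upTo-insert : ∀ m j → 1 ≤ j → j ≤ suc m → applyUpTo suc (suc m) ↭ j ∷ map (bump j) (applyUpTo suc m)
upTo-insert m 1 _ _ = ↭-reflexive (cong (1 ∷_) (sym (map-applyUpTo suc (bump 1) m)))
upTo-insert (suc m) (suc (suc j)) _ (s≤s j<m+1) =
  ↭-trans (↭-reflexive (upTo-suc (suc m)))
  (↭-trans (prep 1 (Perm.map⁺ suc (upTo-insert m (suc j) (s≤s z≤n) j<m+1)))
  (↭-trans (swap 1 (suc (suc j)) ↭-refl)
           (↭-reflexive (cong (λ xs → suc (suc j) ∷ 1 ∷ xs) bumped))))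
  where
  U = applyUpTo suc m
  bumped : map suc (map (bump (suc j)) U) ≡ map (bump (suc (suc j))) (applyUpTo (suc ∘ suc) m)
  bumped = begin
    map suc (map (bump (suc j)) U)       ≡⟨ map-∘ U ⟨
    map (suc ∘ bump (suc j)) U           ≡⟨ map-cong (λ x → sym (bump-suc (suc j) x)) U ⟩
    map (bump (suc (suc j)) ∘ suc) U     ≡⟨ map-∘ U ⟩
    map (bump (suc (suc j))) (map suc U) ≡⟨ cong (map (bump (suc (suc j)))) (map-applyUpTo suc suc m) ⟩
    map (bump (suc (suc j))) (applyUpTo (suc ∘ suc) m) ∎
    where open ≡-Reasoning

up-perm : ∀ {m s} i j → IsPerm m s → 1 ≤ j → j ≤ suc m → IsPerm (suc m) (up s i j)
up-perm {m} {s} i j s↭ 1≤j j≤m+1 =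
  ↭-trans (insAt-↭ (i ∸ 1) j _)
  (↭-trans (prep j (Perm.map⁺ (bump j) s↭)) (↭-sym (upTo-insert m j 1≤j j≤m+1)))

delete-letter : ∀ {τ L} j → τ ↭ j ∷ map (bump j) L →
  ∃ λ i → (1 ≤ i) × (i ≤ length τ) × ∃ λ s → (s ↭ L) × (τ ≡ up s i j)
delete-letter {τ} {L} j τ↭ with ∈⇒insAt (∈-resp-↭ (↭-sym τ↭) (here refl))
... | p , rest , refl , p<len =
  suc p , s≤s z≤n , p<len , map (unbump j) rest , s↭ , cong (insAt p j) (sym restored)
  where
  rest↭ : rest ↭ map (bump j) L
  rest↭ = drop-∷ (↭-trans (↭-sym (insAt-↭ p j rest)) τ↭)
  j∉rest : j ∉ rest
  j∉rest j∈rest with ∈-map⁻ (bump j) (∈-resp-↭ rest↭ j∈rest)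
  ... | x , _ , j≡bump = bump-≢ j x (sym j≡bump)
  s↭ : map (unbump j) rest ↭ L
  s↭ = ↭-trans (Perm.map⁺ (unbump j) rest↭)
         (↭-reflexive (trans (sym (map-∘ L)) (map-id-local (All.tabulate λ {x} _ → unbump-bump j x))))
  restored : map (bump j) (map (unbump j) rest) ≡ rest
  restored = trans (sym (map-∘ rest))
    (map-id-local (All.tabulate λ {x} x∈rest → bump-unbump j x λ { refl → j∉rest x∈rest }))

perm-delete : ∀ {m τ} j → IsPerm (suc m) τ → 1 ≤ j → j ≤ suc m →
  ∃ λ i → (1 ≤ i) × (i ≤ suc m) × ∃ λ s → IsPerm m s × (τ ≡ up s i j)
perm-delete {m} j τ↭ 1≤j j≤m+1 with delete-letter j (↭-trans τ↭ (upTo-insert m j 1≤j j≤m+1))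
... | i , 1≤i , i≤len , s , s↭ , τ≡ =
  i , 1≤i , subst (i ≤_) (trans (↭-length τ↭) (length-applyUpTo suc (suc m))) i≤len , s , s↭ , τ≡

missing : ∀ k (σ : List ℕ) → length σ ≤ k → ∃ λ j → (1 ≤ j) × (j ≤ suc k) × j ∉ σ
missing zero    []  _ = 1 , s≤s z≤n , s≤s z≤n , λ ()
missing (suc k) σ len≤ with suc (suc k) ∈? σ
... | no top∉σ = suc (suc k) , s≤s z≤n , ≤-refl , top∉σ
... | yes top∈σ with ∈-∃++ top∈σ
...   | a , b , refl with missing k (a ++ b) shorter
  where
  shorter : length (a ++ b) ≤ k
  shorter = ≤-pred (≤-trans (≤-reflexive (begin
      suc (length (a ++ b))         ≡⟨ cong suc (length-++ a) ⟩
      suc (length a + length b)     ≡⟨ +-suc (length a) (length b) ⟨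
      length a + suc (length b)     ≡⟨ length-++ a ⟨
      length (a ++ suc (suc k) ∷ b) ∎)) len≤)
    where open ≡-Reasoning
...     | j , 1≤j , j≤k+1 , j∉ab = j , 1≤j , m≤n⇒m≤1+n j≤k+1 , j∉σ
  where
  j∉σ : j ∉ a ++ suc (suc k) ∷ b
  j∉σ j∈σ with ∈-++⁻ a j∈σ
  ... | inj₁ j∈a         = j∉ab (∈-++⁺ˡ j∈a)
  ... | inj₂ (here refl) = 1+n≰n j≤k+1
  ... | inj₂ (there j∈b) = j∉ab (∈-++⁺ʳ a j∈b)

length≤maxLen : ∀ {Π} {π : List ℕ} → π ∈ Π → length π ≤ maxLen Π
length≤maxLen (here refl)  = m≤m⊔n _ _
length≤maxLen (there π∈Π) = ≤-trans (length≤maxLen π∈Π) (m≤n⊔m _ _)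

proposition7p1 : (Π : List (List ℕ)) → Π ≢ [] →
    All (λ π → IsPerm (length π) π) Π →
    (n : ℕ) → maxLen Π < n → (τ : List ℕ) →
    InS n Π τ ⇔
      ((j : ℕ) → 1 ≤ j → j ≤ suc (maxLen Π) →
        ∃ λ i → (1 ≤ i) × (i ≤ n) ×
          ∃ λ s → InS (n ∸ 1) Π s × (τ ≡ up s i j))
proposition7p1 Π _ _ (suc m) k<n τ = mk⇔ toSlices fromSlices
  where
  Slice : ℕ → Set
  Slice j = ∃ λ i → (1 ≤ i) × (i ≤ suc m) × ∃ λ s → InS m Π s × (τ ≡ up s i j)

  toSlices : InS (suc m) Π τ → ∀ j → 1 ≤ j → j ≤ suc (maxLen Π) → Slice j
  toSlices (τ↭ , τ-avoids) j 1≤j j≤k+1 with perm-delete j τ↭ 1≤j (≤-trans j≤k+1 k<n)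
  ... | i , 1≤i , i≤n , s , s↭ , τ≡ =
    i , 1≤i , i≤n , s , (s↭ , avoids-up⁻ i j (subst (Avoids Π) τ≡ τ-avoids)) , τ≡

  -- ⊇: the slice j = 1 gives the permutation property; a hit σ in τ misses
  -- some letter j ≤ k+1, and the slice j pulls σ back to a hit in s.
  fromSlices : (∀ j → 1 ≤ j → j ≤ suc (maxLen Π) → Slice j) → InS (suc m) Π τ
  fromSlices slice = τ↭ , All.tabulate noHit
    where
    τ↭ : IsPerm (suc m) τ
    τ↭ with slice 1 ≤-refl (s≤s z≤n)
    ... | i , _ , _ , s , (s↭ , _) , τ≡ = subst (IsPerm (suc m)) (sym τ≡) (up-perm i 1 s↭ ≤-refl (s≤s z≤n))
    noHit : ∀ {π} → π ∈ Π → ¬ Contains τ π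
    noHit π∈Π (σ , σ⊆τ , iso)
      with missing (maxLen Π) σ (subst (_≤ maxLen Π) (sym (ordIso-length iso)) (length≤maxLen π∈Π))
    ... | j , 1≤j , j≤k+1 , j∉σ with slice j 1≤j j≤k+1
    ... | i , _ , _ , s , (_ , s-avoids) , τ≡ =
      All.lookup s-avoids π∈Π (contains-up⁻ i j (subst (σ ⊆_) τ≡ σ⊆τ) j∉σ iso)
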